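{- Let $\pi$ be a permutation avoiding both patterns $231$ and $4213$. Then $\mathrm{psb}(\pi)$ is an identity permutation.
   Context: A permutation $\pi$ avoids a pattern $\rho\in S_k$ if no subsequence of $\pi$ of length $k$ has its entries in the same relative order as $\rho$. A pop stack is a container where PUSH puts an element on top and POP removes all its elements, appending them to the output from top to bottom. The algorithm PSB processes $\pi=\pi_1\cdots\pi_n$ from left to right with one pop stack $S$ (initially empty) and an initially empty output: for $i=1,\dots,n$, if $S$ is empty or $\pi_i=\mathrm{TOP}(S)-1$ (where $\mathrm{TOP}(S)$ is the top element of $S$), push $\pi_i$; else if $\pi_i<\mathrm{TOP}(S)-1$, append $\pi_i$ directly to the output (bypass); otherwise pop $S$ and then push $\pi_i$. After all entries are processed, pop $S$. The resulting output is denoted $\mathrm{psb}(\pi)$. -}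

module Defs where

open import Data.Nat using (ℕ; zero; suc; _<_; _≟_; _<ᵇ_; _∸_)
open import Data.Bool using (Bool; true; false; if_then_else_)
open import Data.List using (List; []; _∷_; _++_; length; upTo; map; reverse; lookup)
open import Data.List.Relation.Binary.Sublist.Propositional using (_⊆_)
open import Data.List.Relation.Binary.Permutation.Propositional using (_↭_)
open import Data.Fin using (Fin; toℕ; cast)
open import Data.Product using (Σ; _×_; ∃)
open import Relation.Binary.PropositionalEquality using (_≡_)
open import Relation.Nullary using (¬_; yes; no)
open import Function.Bundles using (_⇔_)

IsPerm : ℕ → List ℕ → Set
IsPerm n π = π ↭ map suc (upTo n)

idPerm : ℕ → List ℕ
idPerm n = map suc (upTo n)

OrderIso : List ℕ → List ℕ → Set
OrderIso σ ρ = Σ (length σ ≡ length ρ) λ eq →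
  (i j : Fin (length σ)) →
    (lookup σ i < lookup σ j) ⇔ (lookup ρ (cast eq i) < lookup ρ (cast eq j))

Contains : List ℕ → List ℕ → Set
Contains π ρ = ∃ λ σ → (σ ⊆ π) × OrderIso σ ρ

Avoids : List ℕ → List ℕ → Set
Avoids π ρ = ¬ Contains π ρ

-- Algorithm PSB. The stack is a list with its top at the head; popping
-- appends the stack contents from top to bottom, i.e. the list itself.
psbGo : List ℕ → List ℕ → List ℕ → List ℕ
psbGo out stack [] = out ++ stack
psbGo out [] (x ∷ xs) = psbGo out (x ∷ []) xs
psbGo out (t ∷ st) (x ∷ xs) with suc x ≟ t
... | yes _ = psbGo out (x ∷ t ∷ st) xs
... | no _ = if suc x <ᵇ t
             then psbGo (out ++ (x ∷ [])) (t ∷ st) xs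
             else psbGo (out ++ (t ∷ st)) (x ∷ []) xs

psb : List ℕ → List ℕ
psb π = psbGo [] [] π

-- Read the stack from bottom to top and append the unread input. Since PSB only
-- pushes x onto a top x + 1, the stack is always a run a, a+1, …, a+k (top first),
-- and the word so obtained is a 231- and 4213-avoiding arrangement of an interval
-- [b, b+j) lying above everything already output. Pattern avoidance forces the
-- next output to start at b: a bypassed x with x+1 < a and b < x leaves b and a−1
-- in the input, and either order gives x (a−1) b ≅ 231 or a x b (a−1) ≅ 4213; a
-- popped stack with top a < x and b < a leaves b in the input, and a x b ≅ 231.
-- Hence PSB outputs the interval in increasing order.

module Submission where

open import Defs
open import Data.Nat using (ℕ; zero; suc; _+_; _≤_; _<_; _≮_; _≟_; _<ᵇ_; _<?_; _≤?_; z<s; s≤s)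
open import Data.Nat.Properties
open import Data.Bool using (true; false; T)
open import Data.Unit using (tt)
open import Data.List using (List; []; _∷_; [_]; _++_; _ʳ++_; length; applyUpTo)
import Data.List as List
open import Data.List.Properties using (length-ʳ++; ++-assoc; map-applyUpTo)
open import Data.List.Membership.Propositional using (_∈_)
open import Data.List.Membership.Propositional.Properties using (∈-++⁻)
open import Data.List.Relation.Unary.Any using (here; there)
import Data.List.Relation.Unary.All as All
open import Data.List.Relation.Unary.Unique.Propositional using (Unique; []; _∷_)
open import Data.List.Relation.Unary.Unique.Propositional.Properties using (Unique[x∷xs]⇒x∉xs)
open import Data.List.Relation.Binary.Sublist.Propositional
  using (_⊆_; []; _∷_; _∷ʳ_; ⊆-refl; ⊆-trans; from∈; lookup)
open import Data.List.Relation.Binary.Permutation.Propositional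
  using (_↭_; ↭-sym; ↭-trans; ↭⇒↭ₛ)
open import Data.List.Relation.Binary.Permutation.Propositional.Properties
  using (∈-resp-↭; ↭-length; drop-∷; ++↭ʳ++; ++-comm; ↭-empty-inv)
import Data.List.Relation.Binary.Permutation.Setoid.Properties as Setoid↭
open import Data.Fin using (Fin; zero; suc; cast)
open import Data.Product using (_×_; _,_; proj₁; proj₂)
open import Data.Sum using (_⊎_; inj₁; inj₂; [_,_]′)
open import Function using (_∘_)
open import Relation.Nullary using (¬_; yes; no; contradiction)
open import Relation.Nullary.Decidable using (True; toWitness)
open import Relation.Binary.PropositionalEquality
  using (_≡_; _≢_; refl; sym; trans; cong; cong₂; subst; setoid; module ≡-Reasoning)
open import Function.Bundles using (_⇔_; mk⇔)

interval : ℕ → ℕ → List ℕ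
interval a zero    = []
interval a (suc k) = a ∷ interval (suc a) k

∈-interval⁻ : ∀ {y} a k → y ∈ interval a k → a ≤ y × y < a + k
∈-interval⁻ a (suc k) (here refl) = ≤-refl , m<m+n a z<s
∈-interval⁻ {y} a (suc k) (there y∈) with ∈-interval⁻ (suc a) k y∈
... | a<y , y<1+a+k = <⇒≤ a<y , subst (y <_) (sym (+-suc a k)) y<1+a+k

∈-interval⁺ : ∀ {y} a k → a ≤ y → y < a + k → y ∈ interval a k
∈-interval⁺ a zero a≤y y<a+0 = contradiction (subst (_ <_) (+-identityʳ a) y<a+0) (≤⇒≯ a≤y)
∈-interval⁺ {y} a (suc k) a≤y y<a+1+k with a ≟ y
... | yes refl = here refl
... | no a≢y   = there (∈-interval⁺ (suc a) k (≤∧≢⇒< a≤y a≢y) (subst (y <_) (+-suc a k) y<a+1+k))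

length-interval : ∀ a k → length (interval a k) ≡ k
length-interval a zero    = refl
length-interval a (suc k) = cong suc (length-interval (suc a) k)

interval-++ : ∀ a k l → interval a k ++ interval (a + k) l ≡ interval a (k + l)
interval-++ a zero    l = cong (λ c → interval c l) (+-identityʳ a)
interval-++ a (suc k) l = cong (a ∷_) (begin
  interval (suc a) k ++ interval (a + suc k) l ≡⟨ cong (λ c → interval (suc a) k ++ interval c l) (+-suc a k) ⟩
  interval (suc a) k ++ interval (suc a + k) l ≡⟨ interval-++ (suc a) k l ⟩
  interval (suc a) (k + l)                      ∎)
  where open ≡-Reasoning

Unique-interval : ∀ a k → Unique (interval a k)
Unique-interval a zero    = []
Unique-interval a (suc k) =
  All.tabulate (λ y∈ → <⇒≢ (proj₁ (∈-interval⁻ (suc a) k y∈))) ∷ Unique-interval (suc a) k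

applyUpTo-interval : ∀ f a n → (∀ i → f i ≡ a + i) → applyUpTo f n ≡ interval a n
applyUpTo-interval f a zero    f≗a+ = refl
applyUpTo-interval f a (suc n) f≗a+ = cong₂ _∷_ (trans (f≗a+ 0) (+-identityʳ a))
  (applyUpTo-interval (f ∘ suc) (suc a) n (λ i → trans (f≗a+ (suc i)) (+-suc a i)))

idPerm≡interval : ∀ n → idPerm n ≡ interval 1 n
idPerm≡interval n = trans (map-applyUpTo (λ i → i) suc n) (applyUpTo-interval suc 1 n (λ _ → refl))

private
  variable
    A : Set

Unique-resp-↭ : ∀ {xs ys : List A} → xs ↭ ys → Unique xs → Unique ys
Unique-resp-↭ xs↭ys = Setoid↭.Unique-resp-↭ (setoid _) (↭⇒↭ₛ xs↭ys)

ʳ++↭++ : ∀ (xs ys : List A) → xs ʳ++ ys ↭ ys ++ xs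
ʳ++↭++ xs ys = ↭-trans (↭-sym (++↭ʳ++ xs ys)) (++-comm xs ys)

++-cancelˡ : ∀ (xs : List A) {ys zs} → xs ++ ys ↭ xs ++ zs → ys ↭ zs
++-cancelˡ []       ys↭zs = ys↭zs
++-cancelˡ (x ∷ xs) p     = ++-cancelˡ xs (drop-∷ p)

∈-ʳ++⁻ : ∀ (xs : List A) {ys y} → y ∈ xs ʳ++ ys → y ∈ xs ⊎ y ∈ ys
∈-ʳ++⁻ xs {ys} y∈ = ∈-++⁻ xs (∈-resp-↭ (↭-sym (++↭ʳ++ xs ys)) y∈)

∈-tail : ∀ {x y : A} {xs} → y ∈ x ∷ xs → y ≢ x → y ∈ xs
∈-tail (here y≡x) y≢x = contradiction y≡x y≢x
∈-tail (there y∈) _   = y∈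

⊆-ʳ++ : ∀ (xs : List A) {ys} → ys ⊆ xs ʳ++ ys
⊆-ʳ++ []       = ⊆-refl
⊆-ʳ++ (x ∷ xs) = ⊆-trans (x ∷ʳ ⊆-refl) (⊆-ʳ++ xs)

ʳ++⁺ʳ : ∀ (xs : List A) {ys zs} → ys ⊆ zs → xs ʳ++ ys ⊆ xs ʳ++ zs
ʳ++⁺ʳ []       ys⊆zs = ys⊆zs
ʳ++⁺ʳ (x ∷ xs) ys⊆zs = ʳ++⁺ʳ xs (refl ∷ ys⊆zs)

∈-ʳ++⁺ʳ : ∀ (xs : List A) {ys y} → y ∈ ys → y ∈ xs ʳ++ ys
∈-ʳ++⁺ʳ xs = lookup (⊆-ʳ++ xs)

pair-order : ∀ {y z : A} {l} → y ∈ l → z ∈ l → y ≢ z → y ∷ z ∷ [] ⊆ l ⊎ z ∷ y ∷ [] ⊆ l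
pair-order (here refl) (here refl) y≢z = contradiction refl y≢z
pair-order (here refl) (there z∈)  _   = inj₁ (refl ∷ from∈ z∈)
pair-order (there y∈)  (here refl) _   = inj₂ (refl ∷ from∈ y∈)
pair-order {l = x ∷ _} (there y∈) (there z∈) y≢z with pair-order y∈ z∈ y≢z
... | inj₁ yz = inj₁ (x ∷ʳ yz)
... | inj₂ zy = inj₂ (x ∷ʳ zy)

Avoids-⊆ : ∀ {w w′ ρ} → w′ ⊆ w → Avoids w ρ → Avoids w′ ρ
Avoids-⊆ w′⊆w avoids (σ , σ⊆w′ , σ≅ρ) = avoids (σ , ⊆-trans σ⊆w′ w′⊆w , σ≅ρ)

private
  agree< : ∀ {a b c d : ℕ} → a < b → c < d → (a < b ⇔ c < d)
  agree< a<b c<d = mk⇔ (λ _ → c<d) (λ _ → a<b)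

  agree≮ : ∀ {a b c d : ℕ} → b ≤ a → d ≤ c → (a < b ⇔ c < d)
  agree≮ b≤a d≤c = mk⇔ (λ a<b → contradiction a<b (≤⇒≯ b≤a)) (λ c<d → contradiction c<d (≤⇒≯ d≤c))

  decide< : ∀ {c d} {c<d : True (c <? d)} → c < d
  decide< {c<d = c<d} = toWitness c<d

  decide≤ : ∀ {c d} {c≤d : True (c ≤? d)} → c ≤ d
  decide≤ {c≤d = c≤d} = toWitness c≤d

orderIso-231 : ∀ {u v w} → w < u → u < v → OrderIso (u ∷ v ∷ w ∷ []) (2 ∷ 3 ∷ 1 ∷ [])
orderIso-231 {u} {v} {w} w<u u<v = refl , agree
  where
  σ ρ : List ℕ
  σ = u ∷ v ∷ w ∷ []
  ρ = 2 ∷ 3 ∷ 1 ∷ []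
  agree : (i j : Fin 3) → (List.lookup σ i < List.lookup σ j) ⇔ (List.lookup ρ (cast refl i) < List.lookup ρ (cast refl j))
  agree zero                zero                = agree≮ ≤-refl decide≤
  agree zero                (suc zero)          = agree< u<v decide<
  agree zero                (suc (suc zero))    = agree≮ (<⇒≤ w<u) decide≤
  agree (suc zero)          zero                = agree≮ (<⇒≤ u<v) decide≤
  agree (suc zero)          (suc zero)          = agree≮ ≤-refl decide≤
  agree (suc zero)          (suc (suc zero))    = agree≮ (<⇒≤ (<-trans w<u u<v)) decide≤
  agree (suc (suc zero))    zero                = agree< w<u decide<
  agree (suc (suc zero))    (suc zero)          = agree< (<-trans w<u u<v) decide<
  agree (suc (suc zero))    (suc (suc zero))    = agree≮ ≤-refl decide≤

orderIso-4213 : ∀ {v₁ v₂ v₃ v₄} → v₁ < v₂ → v₂ < v₃ → v₃ < v₄ →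
               OrderIso (v₄ ∷ v₂ ∷ v₁ ∷ v₃ ∷ []) (4 ∷ 2 ∷ 1 ∷ 3 ∷ [])
orderIso-4213 {v₁} {v₂} {v₃} {v₄} v₁<v₂ v₂<v₃ v₃<v₄ = refl , agree
  where
  σ ρ : List ℕ
  σ = v₄ ∷ v₂ ∷ v₁ ∷ v₃ ∷ []
  ρ = 4 ∷ 2 ∷ 1 ∷ 3 ∷ []
  v₁<v₃ = <-trans v₁<v₂ v₂<v₃
  v₂<v₄ = <-trans v₂<v₃ v₃<v₄
  v₁<v₄ = <-trans v₁<v₂ v₂<v₄
  agree : (i j : Fin 4) → (List.lookup σ i < List.lookup σ j) ⇔ (List.lookup ρ (cast refl i) < List.lookup ρ (cast refl j))
  agree zero                   zero                   = agree≮ ≤-refl decide≤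
  agree zero                   (suc zero)             = agree≮ (<⇒≤ v₂<v₄) decide≤
  agree zero                   (suc (suc zero))       = agree≮ (<⇒≤ v₁<v₄) decide≤
  agree zero                   (suc (suc (suc zero))) = agree≮ (<⇒≤ v₃<v₄) decide≤
  agree (suc zero)             zero                   = agree< v₂<v₄ decide<
  agree (suc zero)             (suc zero)             = agree≮ ≤-refl decide≤
  agree (suc zero)             (suc (suc zero))       = agree≮ (<⇒≤ v₁<v₂) decide≤
  agree (suc zero)             (suc (suc (suc zero))) = agree< v₂<v₃ decide<
  agree (suc (suc zero))       zero                   = agree< v₁<v₄ decide<
  agree (suc (suc zero))       (suc zero)             = agree< v₁<v₂ decide<
  agree (suc (suc zero))       (suc (suc zero))       = agree≮ ≤-refl decide≤
  agree (suc (suc zero))       (suc (suc (suc zero))) = agree< v₁<v₃ decide<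
  agree (suc (suc (suc zero))) zero                   = agree< v₃<v₄ decide<
  agree (suc (suc (suc zero))) (suc zero)             = agree≮ (<⇒≤ v₂<v₃) decide≤
  agree (suc (suc (suc zero))) (suc (suc zero))       = agree≮ (<⇒≤ v₁<v₃) decide≤
  agree (suc (suc (suc zero))) (suc (suc (suc zero))) = agree≮ ≤-refl decide≤

record AvoidingArrangement (b j : ℕ) (w : List ℕ) : Set where
  field
    avoids231  : Avoids w (2 ∷ 3 ∷ 1 ∷ [])
    avoids4213 : Avoids w (4 ∷ 2 ∷ 1 ∷ 3 ∷ [])
    ↭-interval : w ↭ interval b j
open AvoidingArrangement

AvoidingArrangement-⊆ : ∀ {b j b′ j′ w w′} → w′ ⊆ w → AvoidingArrangement b j w →
                        w′ ↭ interval b′ j′ → AvoidingArrangement b′ j′ w′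
AvoidingArrangement-⊆ w′⊆w A w′↭ = record
  { avoids231  = Avoids-⊆ w′⊆w (avoids231 A)
  ; avoids4213 = Avoids-⊆ w′⊆w (avoids4213 A)
  ; ↭-interval = w′↭
  }

module _ {w b j} (w↭ : w ↭ interval b j) where

  ↭-interval-∈⁻ : ∀ {y} → y ∈ w → b ≤ y × y < b + j
  ↭-interval-∈⁻ y∈ = ∈-interval⁻ b j (∈-resp-↭ w↭ y∈)

  ↭-interval-∈⁺ : ∀ {y} → b ≤ y → y < b + j → y ∈ w
  ↭-interval-∈⁺ b≤y y<b+j = ∈-resp-↭ (↭-sym w↭) (∈-interval⁺ b j b≤y y<b+j)

  ↭-interval-Unique : Unique w
  ↭-interval-Unique = Unique-resp-↭ (↭-sym w↭) (Unique-interval b j)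

below-stack-∈ : ∀ a k {ys y} → y ∈ interval a k ʳ++ ys → y < a → y ∈ ys
below-stack-∈ a k y∈ y<a with ∈-ʳ++⁻ (interval a k) y∈
... | inj₁ y∈stack = contradiction (proj₁ (∈-interval⁻ a k y∈stack)) (<⇒≱ y<a)
... | inj₂ y∈ys    = y∈ys

drop-least : ∀ st {x ys b j} → x ≡ b → st ʳ++ (x ∷ ys) ↭ interval b (suc j) → st ʳ++ ys ↭ interval (suc b) j
drop-least st {x} {ys} refl w↭ = ↭-trans (ʳ++↭++ st ys)
  (drop-∷ (↭-trans (↭-sym (ʳ++↭++ st (x ∷ ys))) w↭))

ʳ++-↭-interval-length : ∀ st {ys b j} → st ʳ++ ys ↭ interval b j → j ≡ length st + length ys
ʳ++-↭-interval-length st {ys} {b} {j} w↭ = begin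
  j                           ≡⟨ sym (length-interval b j) ⟩
  length (interval b j)       ≡⟨ sym (↭-length w↭) ⟩
  length (st ʳ++ ys)          ≡⟨ length-ʳ++ st ⟩
  length st + length ys       ∎
  where open ≡-Reasoning

drop-stack : ∀ b k {ys j} → interval b k ʳ++ ys ↭ interval b j →
             j ≡ k + length ys × ys ↭ interval (b + k) (length ys)
drop-stack b k {ys} {j} w↭ =
  j≡ , ++-cancelˡ (interval b k) (↭-trans (++↭ʳ++ (interval b k) ys) (subst (_ ↭_) split w↭))
  where
  j≡ : j ≡ k + length ys
  j≡ = trans (ʳ++-↭-interval-length (interval b k) w↭) (cong (_+ length ys) (length-interval b k))
  split : interval b j ≡ interval b k ++ interval (b + k) (length ys)
  split = trans (cong (interval b) j≡) (sym (interval-++ b k (length ys)))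

least≤top : ∀ a k {ys b j} → interval a (suc k) ʳ++ ys ↭ interval b j → b ≤ a
least≤top a k w↭ = proj₁ (↭-interval-∈⁻ w↭ (∈-ʳ++⁺ʳ (interval (suc a) k) (here refl)))

∈-below-top : ∀ a k {ys b j y} → interval a (suc k) ʳ++ ys ↭ interval b j → b ≤ y → y < a → y ∈ ys
∈-below-top a k w↭ b≤y y<a = below-stack-∈ a (suc k)
  (↭-interval-∈⁺ w↭ b≤y (<-trans y<a (proj₂ (↭-interval-∈⁻ w↭ (∈-ʳ++⁺ʳ (interval (suc a) k) (here refl)))))) y<a

top≢next : ∀ st {a x ys b j} → (a ∷ st) ʳ++ (x ∷ ys) ↭ interval b j → a ≢ x
top≢next st {a} {x} {ys} w↭ a≡x = Unique[x∷xs]⇒x∉xs unique (here a≡x)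
  where
  unique : Unique (a ∷ x ∷ ys ++ st)
  unique = Unique-resp-↭ (ʳ++↭++ st (a ∷ x ∷ ys)) (↭-interval-Unique w↭)

popping⇒top<next : ∀ {a k x xs b j} → interval a (suc k) ʳ++ (x ∷ xs) ↭ interval b j →
                   suc x ≢ a → suc x ≮ a → a < x
popping⇒top<next {a} {k} w↭ 1+x≢a 1+x≮a =
  ≤∧≢⇒< (≤-pred (≤∧≢⇒< (≮⇒≥ 1+x≮a) (1+x≢a ∘ sym))) (top≢next (interval (suc a) k) w↭)

stack-is-interval : ∀ a k {b j} → interval a (suc k) ʳ++ [] ↭ interval b j → interval a (suc k) ≡ interval b j
stack-is-interval a k {b} {j} w↭ = cong₂ interval a≡b (sym j≡)
  where
  b≮a : b ≮ a
  b≮a b<a with ∈-below-top a k w↭ ≤-refl b<a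
  ... | ()
  a≡b : a ≡ b
  a≡b = ≤-antisym (≮⇒≥ b≮a) (least≤top a k w↭)
  j≡ : j ≡ suc k
  j≡ = trans (ʳ++-↭-interval-length (interval a (suc k)) w↭)
             (trans (cong (_+ 0) (length-interval a (suc k))) (+-identityʳ (suc k)))

bypassed-is-least : ∀ {b j a k x xs} → AvoidingArrangement b j (interval a (suc k) ʳ++ (x ∷ xs)) →
                    suc x < a → x ≡ b
bypassed-is-least {b} {j} {suc c} {k} {x} {xs} A (s≤s x<c) = ≤-antisym (≮⇒≥ b≮x) b≤x
  where
  w↭ : interval (suc c) (suc k) ʳ++ (x ∷ xs) ↭ interval b j
  w↭ = ↭-interval A
  b≤x : b ≤ x
  b≤x = proj₁ (↭-interval-∈⁻ w↭ (∈-ʳ++⁺ʳ (interval (suc c) (suc k)) (here refl)))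
  ∈-xs : ∀ {y} → b ≤ y → y < suc c → y ≢ x → y ∈ xs
  ∈-xs b≤y y<1+c y≢x = ∈-tail (∈-below-top (suc c) k w↭ b≤y y<1+c) y≢x
  b≮x : b ≮ x
  b≮x b<x = [ c-b-absent , b-c-absent ]′ (pair-order c∈xs b∈xs (>⇒≢ b<c))
    where
    b<c : b < c
    b<c = <-trans b<x x<c
    c∈xs : c ∈ xs
    c∈xs = ∈-xs (<⇒≤ b<c) (n<1+n c) (>⇒≢ x<c)
    b∈xs : b ∈ xs
    b∈xs = ∈-xs ≤-refl (<-trans b<c (n<1+n c)) (<⇒≢ b<x)
    c-b-absent : ¬ (c ∷ b ∷ [] ⊆ xs)
    c-b-absent c-b = avoids231 A
      (x ∷ c ∷ b ∷ [] , ⊆-trans (refl ∷ c-b) (⊆-ʳ++ (interval (suc c) (suc k))) , orderIso-231 b<x x<c)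
    b-c-absent : ¬ (b ∷ c ∷ [] ⊆ xs)
    b-c-absent b-c = avoids4213 A
      (suc c ∷ x ∷ b ∷ c ∷ [] , ⊆-trans (refl ∷ refl ∷ b-c) (⊆-ʳ++ (interval (suc (suc c)) k)) ,
       orderIso-4213 b<x x<c (n<1+n c))

popped-top-is-least : ∀ {b j a k x xs} → AvoidingArrangement b j (interval a (suc k) ʳ++ (x ∷ xs)) →
                      a < x → a ≡ b
popped-top-is-least {b} {j} {a} {k} {x} {xs} A a<x = ≤-antisym (≮⇒≥ b≮a) (least≤top a k (↭-interval A))
  where
  b≮a : b ≮ a
  b≮a b<a = avoids231 A
    (a ∷ x ∷ b ∷ [] , ⊆-trans (refl ∷ refl ∷ from∈ b∈xs) (⊆-ʳ++ (interval (suc a) k)) , orderIso-231 b<a a<x)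
    where
    b∈xs : b ∈ xs
    b∈xs = ∈-tail (∈-below-top a k (↭-interval A) ≤-refl b<a) (<⇒≢ (<-trans b<a a<x))

psbGo-sorts : ∀ out xs {b j a k} → AvoidingArrangement b j (interval a (suc k) ʳ++ xs) →
              psbGo out (interval a (suc k)) xs ≡ out ++ interval b j
psbGo-sorts out []       {a = a} {k} A = cong (out ++_) (stack-is-interval a k (↭-interval A))
psbGo-sorts out (x ∷ xs) {j = zero} {a} {k} A
  with ∈-resp-↭ (↭-interval A) (∈-ʳ++⁺ʳ (interval a (suc k)) (here refl))
... | ()
psbGo-sorts out (x ∷ xs) {b} {suc j} {a} {k} A with suc x ≟ a
... | yes refl = psbGo-sorts out xs A
... | no 1+x≢a with suc x <ᵇ a in bypass
... | true = begin
  psbGo (out ++ [ x ]) st xs             ≡⟨ psbGo-sorts (out ++ [ x ]) xs A′ ⟩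
  (out ++ [ x ]) ++ interval (suc b) j   ≡⟨ ++-assoc out [ x ] _ ⟩
  out ++ x ∷ interval (suc b) j          ≡⟨ cong (λ y → out ++ y ∷ interval (suc b) j) x≡b ⟩
  out ++ interval b (suc j)              ∎
  where
  open ≡-Reasoning
  st : List ℕ
  st = interval a (suc k)
  x≡b : x ≡ b
  x≡b = bypassed-is-least {k = k} {xs = xs} A (<ᵇ⇒< (suc x) a (subst T (sym bypass) tt))
  A′ : AvoidingArrangement (suc b) j (st ʳ++ xs)
  A′ = AvoidingArrangement-⊆ (ʳ++⁺ʳ st (x ∷ʳ ⊆-refl)) A (drop-least st x≡b (↭-interval A))
... | false with popped-top-is-least {k = k} {xs = xs} A
                   (popping⇒top<next {k = k} {xs = xs} (↭-interval A) 1+x≢a (subst T bypass ∘ <⇒<ᵇ))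
... | refl = begin
  psbGo (out ++ st) [ x ] xs                   ≡⟨ psbGo-sorts (out ++ st) xs A′ ⟩
  (out ++ st) ++ interval (a + suc k) l        ≡⟨ ++-assoc out st _ ⟩
  out ++ (st ++ interval (a + suc k) l)        ≡⟨ cong (out ++_) (interval-++ a (suc k) l) ⟩
  out ++ interval a (suc k + l)                ≡⟨ cong (λ i → out ++ interval a i) (sym (proj₁ split)) ⟩
  out ++ interval a (suc j)                    ∎
  where
  open ≡-Reasoning
  st : List ℕ
  st = interval a (suc k)
  l : ℕ
  l = length (x ∷ xs)
  split : suc j ≡ suc k + l × x ∷ xs ↭ interval (a + suc k) l
  split = drop-stack a (suc k) (↭-interval A)
  A′ : AvoidingArrangement (a + suc k) l (x ∷ xs)
  A′ = AvoidingArrangement-⊆ (⊆-ʳ++ st) A (proj₂ split)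

psb-sorts : ∀ {b j} π → AvoidingArrangement b j π → psb π ≡ interval b j
psb-sorts []       A = sym (↭-empty-inv (↭-sym (↭-interval A)))
psb-sorts (x ∷ xs) A = psbGo-sorts [] xs A

mainTheorem2 : (n : ℕ) (π : List ℕ) → IsPerm n π →
    Avoids π (2 ∷ 3 ∷ 1 ∷ []) → Avoids π (4 ∷ 2 ∷ 1 ∷ 3 ∷ []) →
    psb π ≡ idPerm n
mainTheorem2 n π π↭idPerm avoids231 avoids4213 =
  trans (psb-sorts π arrangement) (sym (idPerm≡interval n))
  where
  arrangement : AvoidingArrangement 1 n π
  arrangement = record
    { avoids231  = avoids231
    ; avoids4213 = avoids4213
    ; ↭-interval = subst (π ↭_) (idPerm≡interval n) π↭idPerm
    }
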